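{- Let $\mathcal{C}$ be an rc-invariant permutation class. (a) Let $\sigma\in\mathcal{C}$, and for a permutation $\alpha$ let $\mathcal{C}(\alpha)$ denote the class of permutations in $\mathcal{C}$ avoiding $\alpha$. The following are equivalent: (i) $\sigma\in\widehat{\mathcal{C}}$, i.e. $\sigma$ lies in every permutation class $\mathcal{D}$ with $\mathcal{C}=\mathcal{D}\cup\mathrm{rc}(\mathcal{D})$; (ii) $\mathcal{C}(\sigma)\cup\mathcal{C}(\mathrm{rc}(\sigma))\neq\mathcal{C}$; (iii) there is $\pi\in\mathcal{C}$ that contains both $\sigma$ and $\mathrm{rc}(\sigma)$. (b) $\mathcal{C}$ is rc-atomic if and only if for every $\sigma\in\mathcal{C}$ there is $\pi\in\mathcal{C}$ containing both $\sigma$ and $\mathrm{rc}(\sigma)$. (c) Every centrosymmetric permutation in $\mathcal{C}$ lies in $\widehat{\mathcal{C}}$; that is, the set of centrosymmetric elements of $\mathcal{C}$ equals the set of centrosymmetric elements of $\widehat{\mathcal{C}}$.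
   Context: A permutation of size $n$ is a bijection of $[n]$; $\pi$ contains $\sigma$ if some subsequence of $\pi$ has the same relative order as $\sigma$ (otherwise $\pi$ avoids $\sigma$); a permutation class is a set of permutations closed downward under containment. For $\pi$ of size $n$, $\mathrm{rc}(\pi)(i)=n+1-\pi(n+1-i)$; $\pi$ is centrosymmetric if $\mathrm{rc}(\pi)=\pi$; $\mathrm{rc}(\mathcal{D})=\{\mathrm{rc}(\pi):\pi\in\mathcal{D}\}$; $\mathcal{C}$ is rc-invariant if $\mathrm{rc}(\mathcal{C})=\mathcal{C}$. For rc-invariant $\mathcal{C}$, $\widehat{\mathcal{C}}$ is the intersection of all permutation classes $\mathcal{D}$ such that $\mathcal{C}=\mathcal{D}\cup\mathrm{rc}(\mathcal{D})$; $\mathcal{C}$ is called rc-atomic if $\widehat{\mathcal{C}}=\mathcal{C}$. -}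

module Defs where

open import Level using (0ℓ) renaming (suc to lsuc)
open import Data.Nat using (ℕ)
open import Data.Fin using (Fin; toℕ; opposite; _<_)
open import Data.Fin.Properties using (opposite-involutive)
open import Data.Product using (Σ; ∃; _×_; _,_)
open import Function using (_∘_)
open import Function.Bundles using (_⇔_)
open import Function.Definitions using (Bijective)
import Function.Construct.Composition as Comp
open import Relation.Binary.PropositionalEquality using (_≡_; refl; cong; sym; trans)
open import Relation.Unary using (Pred; _∪_; _≐_)
open import Relation.Nullary using (¬_)

record Perm : Set where
  constructor perm
  field
    size : ℕ
    fun  : Fin size → Fin size
    bij  : Bijective _≡_ _≡_ fun

open Perm public

_≼_ : Perm → Perm → Set
σ ≼ π = Σ (Fin (size σ) → Fin (size π)) λ e →
          (∀ i j → i < j → e i < e j) ×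
          (∀ i j → (fun σ i < fun σ j) ⇔ (fun π (e i) < fun π (e j)))

Avoids : Perm → Perm → Set
Avoids π σ = ¬ (σ ≼ π)

_≡ₚ_ : Perm → Perm → Set
π ≡ₚ σ = (size π ≡ size σ) ×
         (∀ i j → toℕ i ≡ toℕ j → toℕ (fun π i) ≡ toℕ (fun σ j))

private
  opposite-bij : ∀ {n} → Bijective _≡_ _≡_ (opposite {n})
  opposite-bij = inj , surj
    where
    inj : ∀ {i j} → opposite i ≡ opposite j → i ≡ j
    inj {i} {j} p = trans (sym (opposite-involutive i))
                      (trans (cong opposite p) (opposite-involutive j))
    surj : ∀ y → ∃ λ x → ∀ {z} → z ≡ x → opposite z ≡ y
    surj y = opposite y , λ { refl → opposite-involutive y }

-- reverse-complement: rc(π)(i) = n+1-π(n+1-i)  (0-indexed: opposite ∘ π ∘ opposite)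
rc : Perm → Perm
rc (perm n f b) = perm n (opposite ∘ f ∘ opposite)
  (Comp.bijective _≡_ _≡_ _≡_
    (Comp.bijective _≡_ _≡_ _≡_ opposite-bij b) opposite-bij)

Centrosymmetric : Perm → Set
Centrosymmetric π = rc π ≡ₚ π

IsClass : Pred Perm 0ℓ → Set
IsClass C = ∀ {σ π} → σ ≼ π → C π → C σ

rcSet : Pred Perm 0ℓ → Pred Perm 0ℓ
rcSet D σ = ∃ λ π → D π × (rc π ≡ₚ σ)

RcInvariant : Pred Perm 0ℓ → Set
RcInvariant C = rcSet C ≐ C

Hat : Pred Perm 0ℓ → Pred Perm (lsuc 0ℓ)
Hat C σ = ∀ (D : Pred Perm 0ℓ) → IsClass D → C ≐ (D ∪ rcSet D) → D σ

RcAtomic : Pred Perm 0ℓ → Set₁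
RcAtomic C = Hat C ≐ C

Av : Pred Perm 0ℓ → Perm → Pred Perm 0ℓ
Av C α π = C π × Avoids π α

ContainsBothIn : Pred Perm 0ℓ → Perm → Set
ContainsBothIn C σ = ∃ λ π → C π × σ ≼ π × rc σ ≼ π

module Submission where

open import Defs
open import Level using (0ℓ)
open import Data.Product using (_×_)
open import Function.Bundles using (_⇔_)
open import Relation.Unary using (Pred; _∪_; _≐_)
open import Relation.Nullary using (¬_)
open import Axiom.ExcludedMiddle using (ExcludedMiddle)

open import Data.Nat as ℕ using (suc; s≤s)
open import Data.Nat.Properties using (∸-monoʳ-<)
open import Data.Fin using (Fin; toℕ; opposite; cast) renaming (_<_ to _<ᶠ_)
open import Data.Fin.Properties using (opposite-prop; opposite-involutive; toℕ-cast; toℕ<n; toℕ-injective)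
open import Data.Product using (_,_; proj₁; proj₂)
open import Data.Sum using (inj₁; inj₂)
open import Data.Empty using (⊥-elim)
open import Function using (id; _∘_)
open import Function.Bundles using (mk⇔)
import Function.Properties.Equivalence as ⇔
open import Relation.Nullary using (yes; no)
open import Relation.Binary.PropositionalEquality

-- If C = C(σ) ∪ C(rc σ), then D = C(σ) is a class with C = D ∪ rc(D), since π avoids
-- rc σ exactly when rc π avoids σ; as σ ∉ D, σ ∉ Ĉ. If instead some π ∈ C contains both
-- σ and rc σ, then every D with C = D ∪ rc(D) contains π or rc π, and σ lies below either
-- of them, so σ ∈ Ĉ. Excluded middle is needed only to extract such a π from the failure
-- of C = C(σ) ∪ C(rc σ).

≼-refl : ∀ σ → σ ≼ σ
≼-refl σ = id , (λ _ _ → id) , (λ _ _ → ⇔.refl)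

≼-trans : ∀ {σ τ π} → σ ≼ τ → τ ≼ π → σ ≼ π
≼-trans (e , e-mono , e-ord) (e′ , e′-mono , e′-ord) =
  (λ i → e′ (e i)) ,
  (λ i j i<j → e′-mono _ _ (e-mono i j i<j)) ,
  (λ i j → ⇔.trans (e-ord i j) (e′-ord (e i) (e j)))

≡ₚ-refl : ∀ π → π ≡ₚ π
≡ₚ-refl π = refl , λ i j i≡j → cong (toℕ ∘ fun π) (toℕ-injective i≡j)

≡ₚ-sym : ∀ {π σ} → π ≡ₚ σ → σ ≡ₚ π
≡ₚ-sym (n≡m , same) = sym n≡m , λ i j i≡j → sym (same j i (sym i≡j))

≡ₚ⇒≼ : ∀ {π σ} → π ≡ₚ σ → π ≼ σ
≡ₚ⇒≼ {π} {σ} (n≡m , same) = cast n≡m , mono , ord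
  where
  cast-toℕ : ∀ i → toℕ i ≡ toℕ (cast n≡m i)
  cast-toℕ i = sym (toℕ-cast n≡m i)
  mono : ∀ i j → i <ᶠ j → cast n≡m i <ᶠ cast n≡m j
  mono i j = subst₂ ℕ._<_ (cast-toℕ i) (cast-toℕ j)
  values : ∀ i → toℕ (fun π i) ≡ toℕ (fun σ (cast n≡m i))
  values i = same i _ (cast-toℕ i)
  ord : ∀ i j → (fun π i <ᶠ fun π j) ⇔ (fun σ (cast n≡m i) <ᶠ fun σ (cast n≡m j))
  ord i j = mk⇔ (subst₂ ℕ._<_ (values i) (values j))
                (subst₂ ℕ._<_ (sym (values i)) (sym (values j)))

≡ₚ⇒≽ : ∀ {π σ} → π ≡ₚ σ → σ ≼ π
≡ₚ⇒≽ {π} {σ} π≡σ = ≡ₚ⇒≼ {σ} {π} (≡ₚ-sym {π} {σ} π≡σ)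

opposite-< : ∀ {n} {i j : Fin n} → i <ᶠ j → opposite j <ᶠ opposite i
opposite-< {n} {i} {j} i<j = subst₂ ℕ._<_ (sym (opposite-prop j)) (sym (opposite-prop i))
  (∸-monoʳ-< (s≤s i<j) (toℕ<n j))

opposite-<-⇔ : ∀ {n} {i j : Fin n} → (i <ᶠ j) ⇔ (opposite j <ᶠ opposite i)
opposite-<-⇔ {i = i} {j} = mk⇔ opposite-<
  (λ oj<oi → subst₂ _<ᶠ_ (opposite-involutive i) (opposite-involutive j) (opposite-< oj<oi))

rc-involutive : ∀ π → rc (rc π) ≡ₚ π
rc-involutive π = refl , λ i j i≡j → cong toℕ (begin
    opposite (opposite (fun π (opposite (opposite i)))) ≡⟨ opposite-involutive _ ⟩
    fun π (opposite (opposite i))                       ≡⟨ cong (fun π) (opposite-involutive i) ⟩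
    fun π i                                             ≡⟨ cong (fun π) (toℕ-injective i≡j) ⟩
    fun π j                                             ∎)
  where open ≡-Reasoning

rc-mono : ∀ {σ π} → σ ≼ π → rc σ ≼ rc π
rc-mono {σ} {π} (e , e-mono , e-ord) = ē , ē-mono , ē-ord
  where
  ē : Fin (size σ) → Fin (size π)
  ē i = opposite (e (opposite i))
  ē-mono : ∀ i j → i <ᶠ j → ē i <ᶠ ē j
  ē-mono i j i<j = opposite-< (e-mono _ _ (opposite-< i<j))
  unfold : ∀ i → fun π (e (opposite i)) ≡ fun π (opposite (ē i))
  unfold i = cong (fun π) (sym (opposite-involutive _))
  ē-ord : ∀ i j → (opposite (fun σ (opposite i)) <ᶠ opposite (fun σ (opposite j)))
                ⇔ (opposite (fun π (opposite (ē i))) <ᶠ opposite (fun π (opposite (ē j))))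
  ē-ord i j = ⇔.trans (⇔.sym opposite-<-⇔)
             (⇔.trans (e-ord (opposite j) (opposite i))
             (⇔.trans (mk⇔ (subst₂ _<ᶠ_ (unfold j) (unfold i))
                           (subst₂ _<ᶠ_ (sym (unfold j)) (sym (unfold i))))
                      opposite-<-⇔))

rc-rc-≼ : ∀ π → rc (rc π) ≼ π
rc-rc-≼ π = ≡ₚ⇒≼ {rc (rc π)} {π} (rc-involutive π)

≼-rc-rc : ∀ π → π ≼ rc (rc π)
≼-rc-rc π = ≡ₚ⇒≽ {rc (rc π)} {π} (rc-involutive π)

≼-rc⇒rc-≼ : ∀ {σ π} → σ ≼ rc π → rc σ ≼ π
≼-rc⇒rc-≼ {σ} {π} σ≼rcπ =
  ≼-trans {rc σ} {rc (rc π)} {π} (rc-mono {σ} {rc π} σ≼rcπ) (rc-rc-≼ π)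

rc-≼-rc⇒≼ : ∀ {σ π} → rc σ ≼ rc π → σ ≼ π
rc-≼-rc⇒≼ {σ} {π} rcσ≼rcπ =
  ≼-trans {σ} {rc (rc σ)} {π} (≼-rc-rc σ) (≼-rc⇒rc-≼ {rc σ} {π} rcσ≼rcπ)

Av-isClass : ∀ {C} → IsClass C → ∀ σ → IsClass (Av C σ)
Av-isClass isClass σ {τ} {π} τ≼π (Cπ , π-avoids) =
  isClass τ≼π Cπ , λ σ≼τ → π-avoids (≼-trans {σ} {τ} {π} σ≼τ τ≼π)

Splits : Pred Perm 0ℓ → Perm → Set
Splits C σ = (Av C σ ∪ Av C (rc σ)) ≐ C

module _ {C : Pred Perm 0ℓ} where

  Av-∪-Av⊆ : ∀ {σ τ π} → (Av C σ ∪ Av C τ) π → C π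
  Av-∪-Av⊆ (inj₁ (Cπ , _)) = Cπ
  Av-∪-Av⊆ (inj₂ (Cπ , _)) = Cπ

  containsBoth⇒¬splits : ∀ σ → ContainsBothIn C σ → ¬ Splits C σ
  containsBoth⇒¬splits σ (π , Cπ , σ≼π , rcσ≼π) (_ , cover) with cover Cπ
  ... | inj₁ (_ , π-avoids) = π-avoids σ≼π
  ... | inj₂ (_ , π-avoids) = π-avoids rcσ≼π

  ¬splits⇒containsBoth : ExcludedMiddle 0ℓ → ∀ σ → ¬ Splits C σ → ContainsBothIn C σ
  ¬splits⇒containsBoth em σ ¬splits with em {ContainsBothIn C σ}
  ... | yes both = both
  ... | no ¬both = ⊥-elim (¬splits (Av-∪-Av⊆ {σ} {rc σ} , cover))
    where
    cover : ∀ {π} → C π → (Av C σ ∪ Av C (rc σ)) π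
    cover {π} Cπ with em {σ ≼ π} | em {rc σ ≼ π}
    ... | no σ⋠π  | _          = inj₁ (Cπ , σ⋠π)
    ... | yes _   | no rcσ⋠π   = inj₂ (Cπ , rcσ⋠π)
    ... | yes σ≼π | yes rcσ≼π  = ⊥-elim (¬both (π , Cπ , σ≼π , rcσ≼π))

  containsBoth⇒Hat : ∀ σ → ContainsBothIn C σ → Hat C σ
  containsBoth⇒Hat σ (π , Cπ , σ≼π , rcσ≼π) D isClassD (C⊆ , _) with C⊆ Cπ
  ... | inj₁ Dπ = isClassD σ≼π Dπ
  ... | inj₂ (τ , Dτ , rcτ≡π) =
    isClassD (rc-≼-rc⇒≼ {σ} {τ} (≼-trans {rc σ} {π} {rc τ} rcσ≼π (≡ₚ⇒≽ {rc τ} {π} rcτ≡π))) Dτ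

  centrosymmetric⇒containsBoth : ∀ σ → C σ → Centrosymmetric σ → ContainsBothIn C σ
  centrosymmetric⇒containsBoth σ Cσ rcσ≡σ = σ , Cσ , ≼-refl σ , ≡ₚ⇒≼ {rc σ} {σ} rcσ≡σ

module _ {C : Pred Perm 0ℓ} (isClass : IsClass C) (invariant : RcInvariant C) where

  rc-closed : ∀ {π} → C π → C (rc π)
  rc-closed {π} Cπ = proj₁ invariant (π , Cπ , ≡ₚ-refl (rc π))

  Hat⊆ : ∀ σ → Hat C σ → C σ
  Hat⊆ σ σ∈Ĉ = σ∈Ĉ C isClass (inj₁ , λ { (inj₁ Cπ) → Cπ ; (inj₂ π∈rcC) → proj₁ invariant π∈rcC })

  Av-decomposes : ∀ σ → Splits C σ → C ≐ (Av C σ ∪ rcSet (Av C σ))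
  Av-decomposes σ (_ , cover) = decompose , recompose
    where
    decompose : ∀ {π} → C π → (Av C σ ∪ rcSet (Av C σ)) π
    decompose {π} Cπ with cover Cπ
    ... | inj₁ σ-avoider = inj₁ σ-avoider
    ... | inj₂ (_ , π-avoids) =
      inj₂ (rc π , (rc-closed Cπ , π-avoids ∘ ≼-rc⇒rc-≼ {σ} {π}) , rc-involutive π)
    recompose : ∀ {π} → (Av C σ ∪ rcSet (Av C σ)) π → C π
    recompose (inj₁ (Cπ , _)) = Cπ
    recompose (inj₂ (τ , (Cτ , _) , rcτ≡π)) = proj₁ invariant (τ , Cτ , rcτ≡π)

  Hat⇒¬splits : ∀ σ → Hat C σ → ¬ Splits C σ
  Hat⇒¬splits σ σ∈Ĉ splits =
    proj₂ (σ∈Ĉ (Av C σ) (Av-isClass {C} isClass σ) (Av-decomposes σ splits)) (≼-refl σ)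

proposition2p4 : ExcludedMiddle 0ℓ → (C : Pred Perm 0ℓ) → IsClass C → RcInvariant C →
    -- (a): (i) ⇔ (ii) and (ii) ⇔ (iii), for every σ ∈ C
    (∀ σ → C σ →
        (Hat C σ ⇔ (¬ ((Av C σ ∪ Av C (rc σ)) ≐ C)))
      × ((¬ ((Av C σ ∪ Av C (rc σ)) ≐ C)) ⇔ ContainsBothIn C σ))
    -- (b)
  × (RcAtomic C ⇔ (∀ σ → C σ → ContainsBothIn C σ))
    -- (c)
  × ((∀ σ → C σ → Centrosymmetric σ → Hat C σ)
    × ((λ σ → C σ × Centrosymmetric σ) ≐ (λ σ → Hat C σ × Centrosymmetric σ)))
proposition2p4 em C isClass invariant =
    (λ σ _ → mk⇔ (Hat⇒¬splits isClass invariant σ)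
                 (containsBoth⇒Hat σ ∘ ¬splits⇒containsBoth em σ)
           , mk⇔ (¬splits⇒containsBoth em σ) (containsBoth⇒¬splits σ))
  , mk⇔ (λ atomic σ Cσ → Hat⇒containsBoth σ (proj₂ atomic Cσ))
        (λ both → (λ {σ} → Hat⊆ isClass invariant σ)
                 , (λ {σ} Cσ → containsBoth⇒Hat σ (both σ Cσ)))
  , centrosymmetric⇒Hat
  , (λ {σ} (Cσ , centro) → centrosymmetric⇒Hat σ Cσ centro , centro)
  , (λ {σ} (σ∈Ĉ , centro) → Hat⊆ isClass invariant σ σ∈Ĉ , centro)
  where
  Hat⇒containsBoth : ∀ σ → Hat C σ → ContainsBothIn C σ
  Hat⇒containsBoth σ = ¬splits⇒containsBoth em σ ∘ Hat⇒¬splits isClass invariant σ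
  centrosymmetric⇒Hat : ∀ σ → C σ → Centrosymmetric σ → Hat C σ
  centrosymmetric⇒Hat σ Cσ centro = containsBoth⇒Hat σ (centrosymmetric⇒containsBoth σ Cσ centro)
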